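{- Let $n\ge1$ and let $a_1,\dots,a_n$ be integers with $a_1\ge1$ and $a_i\ge2$ for $i=2,\dots,n$. Then the snake $S(a_1,\dots,a_n)$ is isomorphic to the cycle (graphic) matroid of the multi-fan $F(c,d)$, where \[ c=\begin{cases}(a_1+1) & \text{if } n=1,\\ (a_1,a_3-1,\dots,a_{2k-1}-1,a_{2k+1}) & \text{if } n=2k+1>1,\\ (a_1,a_3-1,\dots,a_{2k-1}-1,1) & \text{if } n=2k>1,\end{cases} \qquad d=(a_2-1,a_4-1,\dots,a_{2k}-1) \] (with $d$ empty when $n=1$).
   Context: Lattice path matroids: a lattice path is a sequence of unit steps $N=(0,1)$ and $E=(1,0)$ from the origin. For lattice paths $P,Q$ from $(0,0)$ to $(m,r)$ with $P$ never above $Q$, encoding each path by the positions $\{s_1<\dots<s_r\}$ (for $P$) and $\{t_1<\dots<t_r\}$ (for $Q$) of its North steps among $\{1,\dots,m+r\}$, the lattice path matroid $M[P,Q]$ is the transversal matroid on $\{1,\dots,m+r\}$ with presentation $A_i=\{t_i,\dots,s_i\}$, $i=1,\dots,r$; equivalently its bases are the $r$-sets whose associated lattice path stays in the closed region (diagram) bounded by $P$ and $Q$. Snakes: an LPM $M[P,Q]$ is a snake if it has at least two elements, is connected (not a direct sum of two nonempty matroids), and its diagram contains no lattice point in its interior. For $n\ge1$, $a_1\ge1$, $a_i\ge2$ ($i\ge2$), $S(a_1,\dots,a_n)$ denotes the snake whose diagram, starting at the origin, consists of $a_1$ unit squares in a row to the right, then $a_2$ squares going up, then $a_3$ squares to the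 right, and so on alternating, up to $a_n$, where the last square of each group coincides with the first square of the next group. $S(1)$ (a single square) is the trivial snake. Multi-fans: for $\ell\ge1$ and vectors of positive integers $c=(c_1,\dots,c_\ell)$, $d=(d_1,\dots,d_{\ell-1})$, the multi-fan $F(c,d)$ is the multigraph consisting of a path $v_1,v_1^2,\dots,v_1^{d_1},v_2,v_2^2,\dots,v_2^{d_2},\dots,v_{\ell-1},v_{\ell-1}^2,\dots,v_{\ell-1}^{d_{\ell-1}},v_\ell$ (so $v_i$ and $v_{i+1}$ are joined by a path of $d_i$ edges) together with one extra vertex $x$ joined to each $v_i$ by a bundle of $c_i$ parallel edges. For $\ell=1$, $F(c_1)$ is a bundle of $c_1$ parallel edges between two vertices. -}

module Defs where

open import Data.Nat using (ℕ; zero; suc; _+_; _∸_; _≤_; _<_)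
open import Data.Bool using (Bool; true; false; not; if_then_else_)
open import Data.List using (List; []; _∷_; _++_; replicate; length; take; lookup)
open import Data.Vec using (Vec; tabulate; toList)
import Data.Vec as Vec
open import Data.Fin using (Fin; zero; suc; fromℕ; inject₁)
open import Data.Fin.Subset using (Subset; _∈_; _⊆_)
open import Data.Product using (Σ; _×_; _,_; proj₁; proj₂)
open import Data.Sum using (_⊎_)
open import Function.Bundles using (_↔_; _⇔_; Inverse)
open import Function.Definitions using (Injective)
open import Relation.Binary.PropositionalEquality using (_≡_)
open import Relation.Nullary using (¬_)

-- Lattice paths.  A lattice path is a list of steps; true = N = (0,1),
-- false = E = (1,0).

Path : Set
Path = List Bool

N E : Bool
N = true
E = false

#N : List Bool → ℕ
#N [] = 0
#N (true ∷ xs) = suc (#N xs)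
#N (false ∷ xs) = #N xs

height : List Bool → ℕ → ℕ
height xs k = #N (take k xs)

-- Lattice path matroid M[P,Q] on the ground set {1,…,m+r}, represented
-- as Fin (length P) (element i ↔ (i+1)-th step).  A subset B of the
-- ground set determines the lattice path whose (i+1)-th step is N iff
-- i ∈ B.  B is a basis iff |B| = r and the path of B stays in the closed
-- region bounded by P (below) and Q (above): after every number k of
-- steps its height lies between those of P and Q (points reached after
-- k steps all lie on the antidiagonal x + y = k).

LPMBasis : (P Q : Path) → Subset (length P) → Set
LPMBasis P Q B =
  (#N (toList B) ≡ #N P) ×
  (∀ k → k ≤ length P →
     (height P k ≤ height (toList B) k) × (height (toList B) k ≤ height Q k))

-- The diagram is a sequence of unit squares, each
-- obtained from the previous one by moving one unit E or N: the moves
-- are E^(a₁-1) N^(a₂-1) E^(a₃-1) … (alternating).  For a ribbon of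
-- squares with move word w, the upper boundary path is Q = N w E and
-- the lower boundary path is P = E w N.

snakeMoves : Bool → List ℕ → List Bool
snakeMoves dir [] = []
snakeMoves dir (a ∷ as) = replicate (a ∸ 1) dir ++ snakeMoves (not dir) as

snakeP snakeQ : List ℕ → Path
snakeP as = E ∷ (snakeMoves E as ++ (N ∷ []))
snakeQ as = N ∷ (snakeMoves E as ++ (E ∷ []))

SnakeBasis : (as : List ℕ) → Subset (length (snakeP as)) → Set
SnakeBasis as = LPMBasis (snakeP as) (snakeQ as)

MultiGraph : Set
MultiGraph = List (ℕ × ℕ)

Edge : MultiGraph → Set
Edge G = Fin (length G)

Joins : (G : MultiGraph) → Edge G → ℕ → ℕ → Set
Joins G e x y = (lookup G e ≡ (x , y)) ⊎ (lookup G e ≡ (y , x))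

-- A cycle of length k+1 ≥ 1: distinct vertices v₀,…,v_k and distinct
-- edges e₀,…,e_k, where e_i joins v_i and v_{i+1} (indices mod k+1).
-- (k = 0: a loop; k = 1: two parallel edges.)
record Cycle (G : MultiGraph) (k : ℕ) : Set where
  field
    vtx  : Fin (suc k) → ℕ
    edg  : Fin (suc k) → Edge G
    vtx-inj : Injective _≡_ _≡_ vtx
    edg-inj : Injective _≡_ _≡_ edg
    joins-step : ∀ (i : Fin k) → Joins G (edg (inject₁ i)) (vtx (inject₁ i)) (vtx (suc i))
    joins-last : Joins G (edg (fromℕ k)) (vtx (fromℕ k)) (vtx zero)

GIndependent : (G : MultiGraph) → Subset (length G) → Set
GIndependent G X = ∀ k (C : Cycle G k) → ¬ (∀ i → Cycle.edg C i ∈ X)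

GBasis : (G : MultiGraph) → Subset (length G) → Set
GBasis G X = GIndependent G X × (∀ Y → X ⊆ Y → GIndependent G Y → Y ⊆ X)

preimage : ∀ {m n} → (Fin m → Fin n) → Subset n → Subset m
preimage f Y = tabulate (λ i → Vec.lookup Y (f i))

MatroidIso : ∀ {m n} → (Subset m → Set) → (Subset n → Set) → Set
MatroidIso {m} {n} BM BN =
  Σ (Fin m ↔ Fin n) λ f → ∀ (Y : Subset n) → BN Y ⇔ BM (preimage (Inverse.to f) Y)

-- Multi-fan F(c,d).  Vertex 0 is x; the path vertices are 1,2,….
-- pathEdges v d : the path v — v+1 — … — v+d of d edges.

pathEdges : ℕ → ℕ → MultiGraph
pathEdges v zero = []
pathEdges v (suc d) = (v , suc v) ∷ pathEdges (suc v) d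

-- multiFan' v c d : v is the current v_i; c = (c_i,…,c_ℓ), d = (d_i,…,d_{ℓ-1}).
-- Only meaningful when length c = length d + 1 (checked in the theorem).
multiFan' : ℕ → List ℕ → List ℕ → MultiGraph
multiFan' v (c ∷ []) [] = replicate c (0 , v)
multiFan' v (c ∷ cs@(_ ∷ _)) (d ∷ ds) =
  replicate c (0 , v) ++ (pathEdges v d ++ multiFan' (v + d) cs ds)
multiFan' v _ _ = []

multiFan : List ℕ → List ℕ → MultiGraph
multiFan c d = multiFan' 1 c d

fanD : List ℕ → List ℕ
fanD (_ ∷ y ∷ rest) = (y ∸ 1) ∷ fanD rest
fanD _ = []

fanCTail : List ℕ → List ℕ
fanCTail (_ ∷ []) = 1 ∷ []
fanCTail (_ ∷ z ∷ []) = z ∷ []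
fanCTail (_ ∷ z ∷ rest@(_ ∷ _)) = (z ∸ 1) ∷ fanCTail rest
fanCTail [] = []

fanC : List ℕ → List ℕ
fanC (a₁ ∷ []) = suc a₁ ∷ []
fanC (a₁ ∷ rest@(_ ∷ _)) = a₁ ∷ fanCTail rest
fanC [] = []

module Submission where

-- Identify the i-th element of the snake with the i-th edge of the multi-fan.  If w is the move
-- word of the snake, the snake is M[E w N, N w E], and the multi-fan is the graph obtained by
-- reading E w E from left to right, an E adding a spoke from the hub x to the current path
-- vertex and an N adding the path edge to the next path vertex.  Both basis families are then
-- recognised by the same two-state automaton reading E w E together with the membership flags
-- of a set: the state says whether the current path vertex is joined to the hub by the chosen
-- edges so far.  For the multi-fan this is the usual description of spanning trees; for the
-- snake, whose diagram has width one, the state says whether the path of the set runs along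
-- the upper or the lower boundary.  On the graph side, every chosen edge of an accepted set
-- crosses a cut {v ≥ l} that no earlier chosen edge crosses, so no cycle is chosen; a rejected
-- set contains a chosen walk from the hub that a chosen spoke closes into a cycle.

open import Defs
open import Data.Nat using (ℕ; zero; suc; _+_; _∸_; _≤_; _<_; z≤n; s≤s; s≤s⁻¹; _≤?_; _≟_)
open import Data.Nat.Properties
  using ( ≤-refl; ≤-reflexive; ≤-trans; ≤-antisym; <-trans; <-irrefl; <-cmp; n≤1+n; <⇒≢; <⇒≱; ≤∧≢⇒<; ≤ᵇ⇒≤
        ; m≤n⇒m<n∨m≡n; m<1+n⇒m<n∨m≡n; suc-injective; +-suc; +-identityʳ; +-comm; +-cancelˡ-≡ )
open import Data.Nat.DivMod using (_mod_; m<n⇒m%n≡m)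
open import Data.Bool using (Bool; true; false; _∧_; if_then_else_)
import Data.Bool as Bool
open import Data.Bool.Properties using (∧-zeroʳ; T-∧; T-≡)
open import Data.List using (List; []; _∷_; _++_; replicate; length; drop; lookup; allFin)
open import Data.List.Properties using (++-assoc; ++-identityʳ; length-++; take-all)
open import Data.List.Extrema.Nat using (argmax; f[xs]≤f[argmax])
open import Data.List.Membership.Propositional.Properties using (∈-allFin)
open import Data.List.Relation.Unary.All using (All; _∷_)
import Data.List.Relation.Unary.All as All
open import Data.Vec using (Vec; toList) renaming ([] to []ᵛ; _∷_ to _∷ᵛ_)
import Data.Vec as Vec
open import Data.Vec.Properties using ([]=⇒lookup; lookup⇒[]=; length-toList; tabulate∘lookup; tabulate-cong)
open import Data.Fin using (Fin; zero; suc; toℕ; fromℕ; fromℕ<; inject₁; cast)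
open import Data.Fin.Properties
  using ( toℕ-injective; toℕ<n; toℕ-fromℕ<; toℕ-fromℕ; toℕ-inject₁; fromℕ≢inject₁; inject₁-injective
        ; cast-involutive; cast-is-id )
open import Data.Fin.Relation.Unary.Top using (view; ‵fromℕ; ‵inject₁)
open import Data.Fin.Subset using (Subset; _∈_; _⊆_; _⊂_)
open import Data.Fin.Subset.Properties using (⊆-refl; ⊆-reflexive; drop-∷-⊆; out⊂in; s⊂s)
open import Data.Maybe using (Maybe; just; nothing)
open import Data.Maybe.Properties using (just-injective)
open import Data.Product using (Σ-syntax; _×_; _,_)
open import Data.Sum using (inj₁; inj₂)
open import Data.Empty using (⊥; ⊥-elim)
open import Function.Base using (id; _∘_; case_of_)
open import Function.Bundles using (Equivalence; _↔_; _⇔_; mk⇔; mk↔ₛ′)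
open import Function.Construct.Composition using (_⇔-∘_)
open import Function.Construct.Symmetry using (⇔-sym)
open import Relation.Binary.Definitions using (tri<; tri≈; tri>)
open import Relation.Binary.PropositionalEquality
  using (_≡_; _≢_; ≢-sym; refl; sym; trans; cong; cong₂; subst; subst₂; module ≡-Reasoning)
open import Relation.Nullary using (¬_; does)
open import Relation.Nullary.Decidable using (dec-true; dec-false)

-- Multi-fans

fanGraph : ℕ → List Bool → MultiGraph
fanGraph v []          = []
fanGraph v (false ∷ w) = (0 , v) ∷ fanGraph v w
fanGraph v (true ∷ w)  = (v , suc v) ∷ fanGraph (suc v) w

length-fanGraph : ∀ v w → length (fanGraph v w) ≡ length w
length-fanGraph v []          = refl
length-fanGraph v (false ∷ w) = cong suc (length-fanGraph v w)
length-fanGraph v (true ∷ w)  = cong suc (length-fanGraph (suc v) w)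

fanGraph-spokes : ∀ v c w → fanGraph v (replicate c false ++ w) ≡ replicate c (0 , v) ++ fanGraph v w
fanGraph-spokes v zero    w = refl
fanGraph-spokes v (suc c) w = cong ((0 , v) ∷_) (fanGraph-spokes v c w)

fanGraph-path : ∀ v d w → fanGraph v (replicate d true ++ w) ≡ pathEdges v d ++ fanGraph (v + d) w
fanGraph-path v zero    w rewrite +-identityʳ v = refl
fanGraph-path v (suc d) w rewrite +-suc v d = cong ((v , suc v) ∷_) (fanGraph-path (suc v) d w)

fanGraph-block : ∀ v c d w →
  fanGraph v (replicate c false ++ replicate d true ++ w) ≡
  replicate c (0 , v) ++ pathEdges v d ++ fanGraph (v + d) w
fanGraph-block v c d w rewrite fanGraph-spokes v c (replicate d true ++ w) | fanGraph-path v d w = refl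

replicate-suc-∷ʳ : ∀ {A : Set} n (x : A) → replicate n x ++ x ∷ [] ≡ replicate (suc n) x
replicate-suc-∷ʳ zero    x = refl
replicate-suc-∷ʳ (suc n) x = cong (x ∷_) (replicate-suc-∷ʳ n x)

multiFan'-fanGraph : ∀ v c b rest → All (2 ≤_) (b ∷ rest) →
  fanGraph v (replicate c false ++ snakeMoves N (b ∷ rest) ++ E ∷ []) ≡
  multiFan' v (c ∷ fanCTail (b ∷ rest)) ((b ∸ 1) ∷ fanD rest)
multiFan'-fanGraph v c b [] _
  rewrite ++-identityʳ (replicate (b ∸ 1) true) = fanGraph-block v c (b ∸ 1) (E ∷ [])
multiFan'-fanGraph v c b (suc z ∷ []) _
  rewrite ++-identityʳ (replicate z false) | ++-assoc (replicate (b ∸ 1) true) (replicate z false) (E ∷ [])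
        | fanGraph-block v c (b ∸ 1) (replicate z false ++ E ∷ [])
        | fanGraph-spokes (v + (b ∸ 1)) z (E ∷ [])
        = cong (λ g → replicate c (0 , v) ++ pathEdges v (b ∸ 1) ++ g) (replicate-suc-∷ʳ z _)
multiFan'-fanGraph v c b (z ∷ t ∷ rest) (_ ∷ _ ∷ rest≥2)
  rewrite ++-assoc (replicate (b ∸ 1) true) (replicate (z ∸ 1) false ++ snakeMoves N (t ∷ rest)) (E ∷ [])
        | ++-assoc (replicate (z ∸ 1) false) (snakeMoves N (t ∷ rest)) (E ∷ [])
        | fanGraph-block v c (b ∸ 1) (replicate (z ∸ 1) false ++ snakeMoves N (t ∷ rest) ++ E ∷ [])
        | multiFan'-fanGraph (v + (b ∸ 1)) (z ∸ 1) t rest rest≥2 = refl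

multiFan-fanGraph : ∀ a₁ rest → 1 ≤ a₁ → All (2 ≤_) rest →
  multiFan (fanC (a₁ ∷ rest)) (fanD (a₁ ∷ rest)) ≡ fanGraph 1 (E ∷ snakeMoves E (a₁ ∷ rest) ++ E ∷ [])
multiFan-fanGraph (suc a) [] _ _
  rewrite ++-identityʳ (replicate a false) | fanGraph-spokes 1 a (E ∷ []) = sym (replicate-suc-∷ʳ (suc a) (0 , 1))
multiFan-fanGraph (suc a) (b ∷ rest) _ rest≥2
  rewrite ++-assoc (replicate a false) (snakeMoves N (b ∷ rest)) (E ∷ []) =
    sym (multiFan'-fanGraph 1 (suc a) b rest rest≥2)

-- Spanning trees of a fan graph

-- treeᵇ linked w xs reads the word w of fanGraph v w along with the flags xs of a set of its edges;
-- linked says whether the current path vertex is joined to the hub.  Words and flag lists of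
-- different lengths are never compared; treeᵇ rejects and forestᵇ accepts them.
treeᵇ : Bool → List Bool → List Bool → Bool
treeᵇ linked [] [] = linked
treeᵇ linked (false ∷ w) (false ∷ xs) = treeᵇ linked w xs
treeᵇ linked (true ∷ w)  (true ∷ xs)  = treeᵇ linked w xs
treeᵇ false  (false ∷ w) (true ∷ xs)  = treeᵇ true w xs
treeᵇ true   (false ∷ w) (true ∷ xs)  = false
treeᵇ true   (true ∷ w)  (false ∷ xs) = treeᵇ false w xs
treeᵇ false  (true ∷ w)  (false ∷ xs) = false
treeᵇ _ [] (_ ∷ _) = false
treeᵇ _ (_ ∷ _) [] = false

forestᵇ : Bool → List Bool → List Bool → Bool
forestᵇ _ [] [] = true
forestᵇ linked (false ∷ w) (false ∷ xs) = forestᵇ linked w xs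
forestᵇ linked (true ∷ w)  (true ∷ xs)  = forestᵇ linked w xs
forestᵇ false  (false ∷ w) (true ∷ xs)  = forestᵇ true w xs
forestᵇ true   (false ∷ w) (true ∷ xs)  = false
forestᵇ _      (true ∷ w)  (false ∷ xs) = forestᵇ false w xs
forestᵇ _ [] (_ ∷ _) = true
forestᵇ _ (_ ∷ _) [] = true

treeᵇ⇒forestᵇ : ∀ linked w xs → treeᵇ linked w xs ≡ true → forestᵇ linked w xs ≡ true
treeᵇ⇒forestᵇ _     []          []           _    = refl
treeᵇ⇒forestᵇ false (false ∷ w) (true ∷ xs)  tree = treeᵇ⇒forestᵇ true w xs tree
treeᵇ⇒forestᵇ true  (false ∷ w) (true ∷ xs)  ()
treeᵇ⇒forestᵇ l     (false ∷ w) (false ∷ xs) tree = treeᵇ⇒forestᵇ l w xs tree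
treeᵇ⇒forestᵇ l     (true ∷ w)  (true ∷ xs)  tree = treeᵇ⇒forestᵇ l w xs tree
treeᵇ⇒forestᵇ true  (true ∷ w)  (false ∷ xs) tree = treeᵇ⇒forestᵇ false w xs tree
treeᵇ⇒forestᵇ false (true ∷ w)  (false ∷ xs) ()
treeᵇ⇒forestᵇ _     []          (_ ∷ _)      ()
treeᵇ⇒forestᵇ _     (false ∷ _) []           ()
treeᵇ⇒forestᵇ _     (true ∷ _)  []           ()

-- The induction needs the initial states to be allowed to differ.
treeᵇ-maximal : ∀ {n s t} w {X Y : Subset n} → s Bool.≤ t →
  treeᵇ s w (toList X) ≡ true → forestᵇ t w (toList Y) ≡ true → X ⊆ Y → s ≡ t × Y ≡ X
treeᵇ-maximal [] {[]ᵛ} {[]ᵛ} Bool.b≤b refl _ _ = refl , refl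
treeᵇ-maximal {s = false} (false ∷ w) {true ∷ᵛ X} {true ∷ᵛ Y} Bool.b≤b tree forest X⊆Y
  with refl , Y≡X ← treeᵇ-maximal w {X} {Y} Bool.b≤b tree forest (drop-∷-⊆ X⊆Y) = refl , cong (true ∷ᵛ_) Y≡X
treeᵇ-maximal (false ∷ w) {false ∷ᵛ X} {false ∷ᵛ Y} s≤t tree forest X⊆Y
  with refl , Y≡X ← treeᵇ-maximal w {X} {Y} s≤t tree forest (drop-∷-⊆ X⊆Y) = refl , cong (false ∷ᵛ_) Y≡X
treeᵇ-maximal {t = false} (false ∷ w) {false ∷ᵛ X} {true ∷ᵛ Y} Bool.b≤b tree forest X⊆Y
  with () ← treeᵇ-maximal w {X} {Y} Bool.f≤t tree forest (drop-∷-⊆ X⊆Y)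
treeᵇ-maximal (true ∷ w) {true ∷ᵛ X} {true ∷ᵛ Y} s≤t tree forest X⊆Y
  with refl , Y≡X ← treeᵇ-maximal w {X} {Y} s≤t tree forest (drop-∷-⊆ X⊆Y) = refl , cong (true ∷ᵛ_) Y≡X
treeᵇ-maximal {s = true} (true ∷ w) {false ∷ᵛ X} {false ∷ᵛ Y} Bool.b≤b tree forest X⊆Y
  with refl , Y≡X ← treeᵇ-maximal w {X} {Y} Bool.b≤b tree forest (drop-∷-⊆ X⊆Y) = refl , cong (false ∷ᵛ_) Y≡X
treeᵇ-maximal {s = true} (true ∷ w) {false ∷ᵛ X} {true ∷ᵛ Y} Bool.b≤b tree forest X⊆Y
  with () ← treeᵇ-maximal w {X} {Y} Bool.f≤t tree forest (drop-∷-⊆ X⊆Y)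
treeᵇ-maximal (_ ∷ _) {true ∷ᵛ X} {false ∷ᵛ Y} _ _ _ X⊆Y = case X⊆Y Vec.here of λ ()

-- A spoke at the end of the word can always link the last path vertex.
forestᵇ-extension : ∀ {n} linked w (X : Subset n) → length (w ++ E ∷ []) ≡ n →
  forestᵇ linked (w ++ E ∷ []) (toList X) ≡ true → treeᵇ linked (w ++ E ∷ []) (toList X) ≡ false →
  Σ[ Y ∈ Subset n ] X ⊂ Y × forestᵇ linked (w ++ E ∷ []) (toList Y) ≡ true
forestᵇ-extension false [] (false ∷ᵛ []ᵛ) refl _ _ = true ∷ᵛ []ᵛ , out⊂in ⊆-refl , refl
forestᵇ-extension false [] (true ∷ᵛ []ᵛ) refl _ ()
forestᵇ-extension true [] (true ∷ᵛ []ᵛ) refl () _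
forestᵇ-extension true [] (false ∷ᵛ []ᵛ) refl _ ()
forestᵇ-extension linked (false ∷ w) (false ∷ᵛ X) refl forest notTree
  with Y , X⊂Y , forestY ← forestᵇ-extension linked w X refl forest notTree = false ∷ᵛ Y , s⊂s X⊂Y , forestY
forestᵇ-extension linked (true ∷ w) (true ∷ᵛ X) refl forest notTree
  with Y , X⊂Y , forestY ← forestᵇ-extension linked w X refl forest notTree = true ∷ᵛ Y , s⊂s X⊂Y , forestY
forestᵇ-extension false (false ∷ w) (true ∷ᵛ X) refl forest notTree
  with Y , X⊂Y , forestY ← forestᵇ-extension true w X refl forest notTree = true ∷ᵛ Y , s⊂s X⊂Y , forestY
forestᵇ-extension true (true ∷ w) (false ∷ᵛ X) refl forest notTree
  with Y , X⊂Y , forestY ← forestᵇ-extension false w X refl forest notTree = false ∷ᵛ Y , s⊂s X⊂Y , forestY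
forestᵇ-extension false (true ∷ w) (false ∷ᵛ X) refl forest _ = true ∷ᵛ X , out⊂in ⊆-refl , forest

_!_ : ∀ {A : Set} → List A → ℕ → Maybe A
[]       ! _     = nothing
(x ∷ xs) ! zero  = just x
(x ∷ xs) ! suc n = xs ! n

module _ {A : Set} where

  drop≡∷ : ∀ o (xs : List A) {y ys} → drop o xs ≡ y ∷ ys → xs ! o ≡ just y × drop (suc o) xs ≡ ys
  drop≡∷ zero    (x ∷ xs) refl = refl , refl
  drop≡∷ (suc o) (x ∷ xs) eq   = drop≡∷ o xs eq

  drop≡[]⇒! : ∀ o (xs : List A) → drop o xs ≡ [] → ∀ {o'} → o ≤ o' → xs ! o' ≡ nothing
  drop≡[]⇒! zero    []       _  _         = refl
  drop≡[]⇒! (suc o) []       _  _         = refl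
  drop≡[]⇒! (suc o) (x ∷ xs) eq (s≤s o≤o') = drop≡[]⇒! o xs eq o≤o'

  !⇒< : ∀ (xs : List A) n {y} → xs ! n ≡ just y → n < length xs
  !⇒< (x ∷ xs) zero    _  = s≤s z≤n
  !⇒< (x ∷ xs) (suc n) eq = s≤s (!⇒< xs n eq)

  !-toℕ : ∀ (xs : List A) i → xs ! toℕ i ≡ just (lookup xs i)
  !-toℕ (x ∷ xs) zero    = refl
  !-toℕ (x ∷ xs) (suc i) = !-toℕ xs i

  !⇒lookup-fromℕ< : ∀ (xs : List A) n (n<len : n < length xs) {y} → xs ! n ≡ just y → lookup xs (fromℕ< n<len) ≡ y
  !⇒lookup-fromℕ< (x ∷ xs) zero    _           refl = refl
  !⇒lookup-fromℕ< (x ∷ xs) (suc n) (s≤s n<len) eq   = !⇒lookup-fromℕ< xs n n<len eq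

  toList-! : ∀ {n} (xs : Vec A n) i → toList xs ! toℕ i ≡ just (Vec.lookup xs i)
  toList-! (x ∷ᵛ xs) zero    = refl
  toList-! (x ∷ᵛ xs) (suc i) = toList-! xs i

-- Cuts and cycles

Monochromatic : (ℕ → Bool) → ℕ × ℕ → Set
Monochromatic f (a , b) = f a ≡ f b

atLeast : ℕ → ℕ → Bool
atLeast l v = does (l ≤? v)

module _ {G : MultiGraph} {e : Edge G} {x y : ℕ} (f : ℕ → Bool) where

  joins-monochromatic⇒≡ : Joins G e x y → Monochromatic f (lookup G e) → f x ≡ f y
  joins-monochromatic⇒≡ (inj₁ e≡xy) mono rewrite e≡xy = mono
  joins-monochromatic⇒≡ (inj₂ e≡yx) mono rewrite e≡yx = sym mono

  joins-≡⇒monochromatic : Joins G e x y → f x ≡ f y → Monochromatic f (lookup G e)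
  joins-≡⇒monochromatic (inj₁ e≡xy) fx≡fy rewrite e≡xy = fx≡fy
  joins-≡⇒monochromatic (inj₂ e≡yx) fx≡fy rewrite e≡yx = sym fx≡fy

chain-≡ : ∀ {A : Set} (g : ℕ → A) {m n} → m ≤ n → (∀ i → m ≤ i → i < n → g i ≡ g (suc i)) → g m ≡ g n
chain-≡ g {n = zero}  z≤n   _    = refl
chain-≡ g {n = suc n} m≤1+n step with m≤n⇒m<n∨m≡n m≤1+n
... | inj₂ refl       = refl
... | inj₁ (s≤s m≤n) =
  trans (chain-≡ g m≤n λ i m≤i i<n → step i m≤i (≤-trans i<n (n≤1+n n))) (step n m≤n ≤-refl)

-- Going round the cycle, the colour of the vertices can only change across the edge i₀,
-- so it does not change there either.
module _ {G : MultiGraph} {k : ℕ} (C : Cycle G k) (f : ℕ → Bool) where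
  open Cycle C
  open ≡-Reasoning

  private
    -- Reducing mod k + 1 only makes colour total; it is used at indices ≤ k.
    colour : ℕ → Bool
    colour n = f (vtx (n mod suc k))

    colour-toℕ : ∀ i → colour (toℕ i) ≡ f (vtx i)
    colour-toℕ i = cong (f ∘ vtx) (toℕ-injective (trans (toℕ-fromℕ< _) (m<n⇒m%n≡m (toℕ<n i))))

    colour-step : ∀ n (n<k : n < k) → Monochromatic f (lookup G (edg (inject₁ (fromℕ< n<k)))) →
                  colour n ≡ colour (suc n)
    colour-step n n<k mono = begin
      colour n                  ≡⟨ cong colour (trans (toℕ-inject₁ j) (toℕ-fromℕ< n<k)) ⟨
      colour (toℕ (inject₁ j))  ≡⟨ colour-toℕ (inject₁ j) ⟩
      f (vtx (inject₁ j))       ≡⟨ joins-monochromatic⇒≡ {G = G} f (joins-step j) mono ⟩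
      f (vtx (suc j))           ≡⟨ colour-toℕ (suc j) ⟨
      colour (suc (toℕ j))      ≡⟨ cong (colour ∘ suc) (toℕ-fromℕ< n<k) ⟩
      colour (suc n)            ∎
      where j = fromℕ< n<k

    colour-last : Monochromatic f (lookup G (edg (fromℕ k))) → colour k ≡ colour 0
    colour-last mono = begin
      colour k                  ≡⟨ cong colour (toℕ-fromℕ k) ⟨
      colour (toℕ (fromℕ k))    ≡⟨ colour-toℕ (fromℕ k) ⟩
      f (vtx (fromℕ k))         ≡⟨ joins-monochromatic⇒≡ {G = G} f joins-last mono ⟩
      f (vtx zero)              ∎

  cycle-monochromatic : ∀ i₀ → (∀ i → i ≢ i₀ → Monochromatic f (lookup G (edg i))) →
                        Monochromatic f (lookup G (edg i₀))
  cycle-monochromatic i₀ mono with view i₀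
  ... | ‵fromℕ = joins-≡⇒monochromatic {G = G} f joins-last (begin
    f (vtx (fromℕ k))    ≡⟨ colour-toℕ (fromℕ k) ⟨
    colour (toℕ (fromℕ k)) ≡⟨ cong colour (toℕ-fromℕ k) ⟩
    colour k             ≡⟨ chain-≡ colour z≤n (λ n _ n<k → colour-step n n<k (mono _ (fromℕ≢inject₁ ∘ sym))) ⟨
    colour 0             ∎)
  ... | ‵inject₁ j₀ = joins-≡⇒monochromatic {G = G} f (joins-step j₀) (begin
    f (vtx (inject₁ j₀))     ≡⟨ colour-toℕ (inject₁ j₀) ⟨
    colour (toℕ (inject₁ j₀)) ≡⟨ cong colour (toℕ-inject₁ j₀) ⟩
    colour n₀                ≡⟨ colour-before ⟨
    colour 0                 ≡⟨ colour-last (mono _ fromℕ≢inject₁) ⟨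
    colour k                 ≡⟨ colour-after ⟨
    colour (suc n₀)          ≡⟨ colour-toℕ (suc j₀) ⟩
    f (vtx (suc j₀))         ∎)
    where
    n₀ = toℕ j₀
    n₀<k : n₀ < k
    n₀<k = toℕ<n j₀
    away : ∀ {n} (n<k : n < k) → n ≢ n₀ → inject₁ (fromℕ< n<k) ≢ inject₁ j₀
    away n<k n≢n₀ eq = n≢n₀ (trans (sym (toℕ-fromℕ< n<k)) (cong toℕ (inject₁-injective eq)))
    colour-before : colour 0 ≡ colour n₀
    colour-before = chain-≡ colour z≤n λ n _ n<n₀ →
      let n<k = <-trans n<n₀ n₀<k in colour-step n n<k (mono _ (away n<k (<⇒≢ n<n₀)))
    colour-after : colour (suc n₀) ≡ colour k
    colour-after = chain-≡ colour n₀<k λ n n₀<n n<k →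
      colour-step n n<k (mono _ (away n<k (≢-sym (<⇒≢ n₀<n))))

-- Acyclicity

module Crossings (G : MultiGraph) (xs : List Bool) where

  Chosen : ℕ → Set
  Chosen i = xs ! i ≡ just true

  ChosenMonochromatic : ℕ → (ℕ → Bool) → Set
  ChosenMonochromatic o f = ∀ i {e} → i < o → Chosen i → G ! i ≡ just e → Monochromatic f e

  EdgesWithin : ℕ → ℕ → Set
  EdgesWithin o v = ∀ i {a b} → i < o → G ! i ≡ just (a , b) → a ≤ v × b ≤ v

  -- The chosen edges before position o separate the path vertices l, …, v from the hub.
  CutOff : ℕ → ℕ → ℕ → Set
  CutOff o v l = 1 ≤ l × l ≤ v × ChosenMonochromatic o (atLeast l)

  FirstCrossing : ℕ → ℕ × ℕ → Set
  FirstCrossing o e = Σ[ l ∈ ℕ ] ¬ Monochromatic (atLeast l) e × ChosenMonochromatic o (atLeast l)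

  edgesWithin-∷ : ∀ {o v v' a b} → EdgesWithin o v → v ≤ v' → G ! o ≡ just (a , b) → a ≤ v' → b ≤ v' →
                  EdgesWithin (suc o) v'
  edgesWithin-∷ within v≤v' Go a≤v' b≤v' i i<1+o Gi with m<1+n⇒m<n∨m≡n i<1+o
  ... | inj₁ i<o with a≤v , b≤v ← within i i<o Gi = ≤-trans a≤v v≤v' , ≤-trans b≤v v≤v'
  ... | inj₂ refl with refl ← trans (sym Gi) Go = a≤v' , b≤v'

  edgesWithin-spoke : ∀ {o v} → EdgesWithin o v → G ! o ≡ just (0 , v) → EdgesWithin (suc o) v
  edgesWithin-spoke within Go = edgesWithin-∷ within ≤-refl Go z≤n ≤-refl

  edgesWithin-path : ∀ {o v} → EdgesWithin o v → G ! o ≡ just (v , suc v) → EdgesWithin (suc o) (suc v)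
  edgesWithin-path {v = v} within Go = edgesWithin-∷ within (n≤1+n v) Go (n≤1+n v) ≤-refl

  chosenMonochromatic-∷ : ∀ {o f} → ChosenMonochromatic o f → (Chosen o → ∀ {e} → G ! o ≡ just e → Monochromatic f e) →
    ChosenMonochromatic (suc o) f
  chosenMonochromatic-∷ mono mono-o i i<1+o chosen Gi with m<1+n⇒m<n∨m≡n i<1+o
  ... | inj₁ i<o  = mono i i<o chosen Gi
  ... | inj₂ refl = mono-o chosen Gi

  unchosen : ∀ {o} → xs ! o ≡ just false → ¬ Chosen o
  unchosen xs-o chosen with () ← trans (sym chosen) xs-o

  below-monochromatic : ∀ l {a b} → a < l → b < l → Monochromatic (atLeast l) (a , b)
  below-monochromatic l a<l b<l = trans (dec-false (_ ≤? _) (<⇒≱ a<l)) (sym (dec-false (_ ≤? _) (<⇒≱ b<l)))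

  above-monochromatic : ∀ l {a b} → l ≤ a → l ≤ b → Monochromatic (atLeast l) (a , b)
  above-monochromatic l l≤a l≤b = trans (dec-true (_ ≤? _) l≤a) (sym (dec-true (_ ≤? _) l≤b))

  crossing : ∀ l {a b} → a < l → l ≤ b → ¬ Monochromatic (atLeast l) (a , b)
  crossing l a<l l≤b mono
    with () ← trans (sym (dec-false (_ ≤? _) (<⇒≱ a<l))) (trans mono (dec-true (_ ≤? _) l≤b))

  chosenMonochromatic-unchosen : ∀ {o f} → ChosenMonochromatic o f → xs ! o ≡ just false →
                                 ChosenMonochromatic (suc o) f
  chosenMonochromatic-unchosen mono xs-o =
    chosenMonochromatic-∷ mono λ chosen _ → ⊥-elim (unchosen xs-o chosen)

  cutOff-unchosen : ∀ {o v l} → CutOff o v l → xs ! o ≡ just false → CutOff (suc o) v l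
  cutOff-unchosen (1≤l , l≤v , mono) xs-o = 1≤l , l≤v , chosenMonochromatic-unchosen mono xs-o

  cutOff-path : ∀ {o v l} → CutOff o v l → G ! o ≡ just (v , suc v) → CutOff (suc o) (suc v) l
  cutOff-path {o} {v} {l} (1≤l , l≤v , mono) Go = 1≤l , l≤1+v , chosenMonochromatic-∷ mono path-monochromatic
    where
    l≤1+v = ≤-trans l≤v (n≤1+n v)
    path-monochromatic : Chosen o → ∀ {e} → G ! o ≡ just e → Monochromatic (atLeast l) e
    path-monochromatic _ Ge with refl ← trans (sym Ge) Go = above-monochromatic l l≤v l≤1+v

  freshCut : ∀ {o v} → EdgesWithin o v → ChosenMonochromatic o (atLeast (suc v))
  freshCut within i i<o _ Gi with a≤v , b≤v ← within i i<o Gi = below-monochromatic (suc _) (s≤s a≤v) (s≤s b≤v)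

  chosen⇒firstCrossing : ∀ o v linked l w ys → drop o G ≡ fanGraph v w → drop o xs ≡ ys →
    EdgesWithin o v → (linked ≡ false → CutOff o v l) → forestᵇ linked w ys ≡ true →
    ∀ {o' e} → o ≤ o' → Chosen o' → G ! o' ≡ just e → FirstCrossing o' e
  chosen⇒firstCrossing o v linked l [] ys G-o _ _ _ _ o≤o' _ Go'
    with () ← trans (sym Go') (drop≡[]⇒! o G G-o o≤o')
  chosen⇒firstCrossing o v linked l (_ ∷ _) [] _ xs-o _ _ _ o≤o' chosen _
    with () ← trans (sym chosen) (drop≡[]⇒! o xs xs-o o≤o')
  chosen⇒firstCrossing o v false l (false ∷ w) (true ∷ ys) G-o xs-o within cut forest o≤o' chosen Go'
    with Go , G-o′ ← drop≡∷ o G G-o | _ , xs-o′ ← drop≡∷ o xs xs-o | m≤n⇒m<n∨m≡n o≤o'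
  ... | inj₂ refl with refl ← trans (sym Go') Go | 1≤l , l≤v , mono ← cut refl = l , crossing l 1≤l l≤v , mono
  ... | inj₁ o<o' =
    chosen⇒firstCrossing (suc o) v true l w ys G-o′ xs-o′ (edgesWithin-spoke within Go) (λ ()) forest o<o' chosen Go'
  chosen⇒firstCrossing o v linked l (false ∷ w) (false ∷ ys) G-o xs-o within cut forest o≤o' chosen Go'
    with Go , G-o′ ← drop≡∷ o G G-o | xs[o] , xs-o′ ← drop≡∷ o xs xs-o | m≤n⇒m<n∨m≡n o≤o'
  ... | inj₂ refl = ⊥-elim (unchosen xs[o] chosen)
  ... | inj₁ o<o' = chosen⇒firstCrossing (suc o) v linked l w ys G-o′ xs-o′ (edgesWithin-spoke within Go)
                      (λ unlinked → cutOff-unchosen (cut unlinked) xs[o]) forest o<o' chosen Go'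
  chosen⇒firstCrossing o v linked l (true ∷ w) (true ∷ ys) G-o xs-o within cut forest o≤o' chosen Go'
    with Go , G-o′ ← drop≡∷ o G G-o | _ , xs-o′ ← drop≡∷ o xs xs-o | m≤n⇒m<n∨m≡n o≤o'
  ... | inj₂ refl with refl ← trans (sym Go') Go = suc v , crossing (suc v) ≤-refl ≤-refl , freshCut within
  ... | inj₁ o<o' = chosen⇒firstCrossing (suc o) (suc v) linked l w ys G-o′ xs-o′ (edgesWithin-path within Go)
                      (λ unlinked → cutOff-path (cut unlinked) Go) forest o<o' chosen Go'
  chosen⇒firstCrossing o v linked l (true ∷ w) (false ∷ ys) G-o xs-o within cut forest o≤o' chosen Go'
    with Go , G-o′ ← drop≡∷ o G G-o | xs[o] , xs-o′ ← drop≡∷ o xs xs-o | m≤n⇒m<n∨m≡n o≤o'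
  ... | inj₂ refl = ⊥-elim (unchosen xs[o] chosen)
  ... | inj₁ o<o' = chosen⇒firstCrossing (suc o) (suc v) false (suc v) w ys G-o′ xs-o′ (edgesWithin-path within Go)
                      (λ _ → s≤s z≤n , ≤-refl , chosenMonochromatic-unchosen (freshCut within) xs[o])
                      forest o<o' chosen Go'

-- A cycle of chosen edges would cross the cut of its last chosen edge only once.
forest⇒independent : ∀ w (X : Subset (length (fanGraph 1 w))) →
  forestᵇ false w (toList X) ≡ true → GIndependent (fanGraph 1 w) X
forest⇒independent w X forest k C allChosen = crossedOnce firstCrossing
  where
  G = fanGraph 1 w
  open Cycle C
  open Crossings G (toList X)

  position : Fin (suc k) → ℕ
  position i = toℕ (edg i)

  last : Fin (suc k)
  last = argmax position zero (allFin (suc k))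

  before-last : ∀ i → i ≢ last → position i < position last
  before-last i i≢last = ≤∧≢⇒< (All.lookup (f[xs]≤f[argmax] {f = position} zero (allFin (suc k))) (∈-allFin i))
                                (λ eq → i≢last (edg-inj (toℕ-injective eq)))

  chosen : ∀ i → Chosen (position i)
  chosen i = trans (toList-! X (edg i)) (cong just ([]=⇒lookup (allChosen i)))

  firstCrossing : FirstCrossing (position last) (lookup G (edg last))
  firstCrossing = chosen⇒firstCrossing 0 1 false 1 w (toList X) refl refl (λ _ ()) (λ _ → ≤-refl , ≤-refl , λ _ ())
                    forest z≤n (chosen last) (!-toℕ G (edg last))

  crossedOnce : FirstCrossing (position last) (lookup G (edg last)) → ⊥
  crossedOnce (l , crosses , earlierMonochromatic) = crosses (cycle-monochromatic C (atLeast l) last λ i i≢last →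
    earlierMonochromatic (position i) (before-last i i≢last) (chosen i) (!-toℕ G (edg i)))

-- Closing chosen walks into cycles

setAt : (ℕ → ℕ) → ℕ → ℕ → ℕ → ℕ
setAt pos m o j = if does (j ≟ m) then o else pos j

setAt-≡ : ∀ pos m o → setAt pos m o m ≡ o
setAt-≡ pos m o rewrite dec-true (m ≟ m) refl = refl

setAt-≢ : ∀ pos m o {j} → j ≢ m → setAt pos m o j ≡ pos j
setAt-≢ pos m o {j} j≢m rewrite dec-false (j ≟ m) j≢m = refl

increasing-< : ∀ (pos : ℕ → ℕ) {m} → (∀ j → j < m → pos j < pos (suc j)) →
  ∀ {i j} → i < j → j ≤ m → pos i < pos j
increasing-< pos inc {i} {suc j} i<1+j 1+j≤m with m<1+n⇒m<n∨m≡n i<1+j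
... | inj₂ refl = inc i 1+j≤m
... | inj₁ i<j  = <-trans (increasing-< pos inc i<j (≤-trans (n≤1+n j) 1+j≤m)) (inc j 1+j≤m)

increasing-injective : ∀ (pos : ℕ → ℕ) {m} → (∀ j → j < m → pos j < pos (suc j)) →
  ∀ {i j} → i ≤ m → j ≤ m → pos i ≡ pos j → i ≡ j
increasing-injective pos inc {i} {j} i≤m j≤m eq with <-cmp i j
... | tri< i<j _ _ = ⊥-elim (<-irrefl eq (increasing-< pos inc i<j j≤m))
... | tri≈ _ i≡j _ = i≡j
... | tri> _ _ j<i = ⊥-elim (<-irrefl (sym eq) (increasing-< pos inc j<i i≤m))

walk : ℕ → ℕ → ℕ
walk u zero    = 0
walk u (suc j) = u + j

walk-injective : ∀ {u} → 1 ≤ u → ∀ {i j} → walk u i ≡ walk u j → i ≡ j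
walk-injective {suc u} _ {zero}  {zero}  _  = refl
walk-injective {suc u} _ {suc i} {suc j} eq = cong suc (+-cancelˡ-≡ (suc u) i j eq)

module Closing (G : MultiGraph) (X : Subset (length G)) where
  open Crossings G (toList X) using (Chosen)

  -- Chosen edges at positions pos 0 < … < pos m < o forming a walk from the hub to v.
  record ChosenWalk (o v : ℕ) : Set where
    field
      u m        : ℕ
      pos        : ℕ → ℕ
      1≤u        : 1 ≤ u
      v≡u+m      : v ≡ u + m
      walk-edge  : ∀ j → j ≤ m → G ! pos j ≡ just (walk u j , walk u (suc j))
      chosen     : ∀ j → j ≤ m → Chosen (pos j)
      increasing : ∀ j → j < m → pos j < pos (suc j)
      pos-m<o    : pos m < o

  startWalk : ∀ {o v} → 1 ≤ v → G ! o ≡ just (0 , v) → Chosen o → ChosenWalk (suc o) v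
  startWalk {o} {v} 1≤v Go chosen-o = record
    { u = v ; m = 0 ; pos = λ _ → o ; 1≤u = 1≤v ; v≡u+m = sym (+-identityʳ v)
    ; walk-edge  = λ { zero _ → subst (λ x → G ! o ≡ just (0 , x)) (sym (+-identityʳ v)) Go }
    ; chosen     = λ { zero _ → chosen-o }
    ; increasing = λ _ ()
    ; pos-m<o    = ≤-refl
    }

  skipEdge : ∀ {o v} → ChosenWalk o v → ChosenWalk (suc o) v
  skipEdge {o} W = record { ChosenWalk W ; pos-m<o = ≤-trans (ChosenWalk.pos-m<o W) (n≤1+n o) }

  module Append {o v} (W : ChosenWalk o v) (chosen-o : Chosen o) where
    open ChosenWalk W public

    pos′ : ℕ → ℕ
    pos′ = setAt pos (suc m) o

    pos′-old : ∀ {j} → j ≤ m → pos′ j ≡ pos j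
    pos′-old {j} j≤m = setAt-≢ pos (suc m) o λ { refl → <-irrefl refl j≤m }

    pos′-new : pos′ (suc m) ≡ o
    pos′-new = setAt-≡ pos (suc m) o

    walk-edge′ : ∀ j → j ≤ m → G ! pos′ j ≡ just (walk u j , walk u (suc j))
    walk-edge′ j j≤m rewrite pos′-old j≤m = walk-edge j j≤m

    chosen′ : ∀ j → j ≤ suc m → Chosen (pos′ j)
    chosen′ j j≤1+m with m≤n⇒m<n∨m≡n j≤1+m
    ... | inj₁ j<1+m rewrite pos′-old (s≤s⁻¹ j<1+m) = chosen j (s≤s⁻¹ j<1+m)
    ... | inj₂ refl  rewrite pos′-new = chosen-o

    increasing′ : ∀ j → j < suc m → pos′ j < pos′ (suc j)
    increasing′ j j<1+m with m<1+n⇒m<n∨m≡n j<1+m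
    ... | inj₁ j<m  rewrite pos′-old (≤-trans (n≤1+n j) j<m) | pos′-old j<m = increasing j j<m
    ... | inj₂ refl rewrite pos′-old (≤-refl {j}) | pos′-new = pos-m<o

  extendWalk : ∀ {o v} → ChosenWalk o v → G ! o ≡ just (v , suc v) → Chosen o → ChosenWalk (suc o) (suc v)
  extendWalk {o} {v} W Go chosen-o = record
    { u = u ; m = suc m ; pos = pos′ ; 1≤u = 1≤u ; v≡u+m = 1+v≡u+1+m
    ; walk-edge  = walk-edge″
    ; chosen     = chosen′
    ; increasing = increasing′
    ; pos-m<o    = subst (_< suc o) (sym pos′-new) ≤-refl
    }
    where
    open Append W chosen-o
    1+v≡u+1+m : suc v ≡ u + suc m
    1+v≡u+1+m = trans (cong suc v≡u+m) (sym (+-suc u m))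
    walk-edge″ : ∀ j → j ≤ suc m → G ! pos′ j ≡ just (walk u j , walk u (suc j))
    walk-edge″ j j≤1+m with m≤n⇒m<n∨m≡n j≤1+m
    ... | inj₁ j<1+m = walk-edge′ j (s≤s⁻¹ j<1+m)
    ... | inj₂ refl rewrite pos′-new = trans Go (cong₂ (λ a b → just (a , b)) v≡u+m 1+v≡u+1+m)

  closeWalk : ∀ {o v} → ChosenWalk o v → G ! o ≡ just (0 , v) → Chosen o → ¬ GIndependent G X
  closeWalk {o} {v} W Go chosen-o independent = independent (suc m) cycle allChosen
    where
    open Append W chosen-o

    closing-edge : G ! pos′ (suc m) ≡ just (0 , walk u (suc m))
    closing-edge rewrite pos′-new = trans Go (cong (λ x → just (0 , x)) v≡u+m)

    toℕ≤ : ∀ (i : Fin (suc (suc m))) → toℕ i ≤ suc m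
    toℕ≤ i = s≤s⁻¹ (toℕ<n i)

    in-range : ∀ j → j ≤ suc m → pos′ j < length G
    in-range j j≤1+m with m≤n⇒m<n∨m≡n j≤1+m
    ... | inj₁ j<1+m = !⇒< G (pos′ j) (walk-edge′ j (s≤s⁻¹ j<1+m))
    ... | inj₂ refl  = !⇒< G (pos′ (suc m)) closing-edge

    edg : Fin (suc (suc m)) → Edge G
    edg i = fromℕ< (in-range (toℕ i) (toℕ≤ i))

    toℕ-edg : ∀ i → toℕ (edg i) ≡ pos′ (toℕ i)
    toℕ-edg i = toℕ-fromℕ< _

    lookup-edg : ∀ i {e} → G ! pos′ (toℕ i) ≡ just e → lookup G (edg i) ≡ e
    lookup-edg i = !⇒lookup-fromℕ< G (pos′ (toℕ i)) (in-range (toℕ i) (toℕ≤ i))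

    step-edge : ∀ (i : Fin (suc m)) → lookup G (edg (inject₁ i)) ≡ (walk u (toℕ (inject₁ i)) , walk u (toℕ (suc i)))
    step-edge i = lookup-edg (inject₁ i) (subst (λ t → G ! pos′ t ≡ just (walk u t , walk u (suc (toℕ i))))
                    (sym (toℕ-inject₁ i)) (walk-edge′ (toℕ i) (s≤s⁻¹ (toℕ<n i))))

    last-edge : lookup G (edg (fromℕ (suc m))) ≡ (0 , walk u (toℕ (fromℕ (suc m))))
    last-edge = lookup-edg (fromℕ (suc m))
                  (subst (λ t → G ! pos′ t ≡ just (0 , walk u t)) (sym (toℕ-fromℕ (suc m))) closing-edge)

    cycle : Cycle G (suc m)
    cycle = record
      { vtx        = λ i → walk u (toℕ i)
      ; edg        = edg
      ; vtx-inj    = λ eq → toℕ-injective (walk-injective 1≤u eq)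
      ; edg-inj    = λ {i} {j} eq → toℕ-injective (increasing-injective pos′ increasing′ (toℕ≤ i) (toℕ≤ j)
                       (trans (sym (toℕ-edg i)) (trans (cong toℕ eq) (toℕ-edg j))))
      ; joins-step = λ i → inj₁ (step-edge i)
      ; joins-last = inj₂ last-edge
      }

    allChosen : ∀ i → edg i ∈ X
    allChosen i = lookup⇒[]= (edg i) X (just-injective
      (trans (sym (toList-! X (edg i))) (trans (cong (toList X !_) (toℕ-edg i)) (chosen′ (toℕ i) (toℕ≤ i)))))

  rejected⇒dependent : ∀ o v linked w ys → drop o G ≡ fanGraph v w → drop o (toList X) ≡ ys → 1 ≤ v →
    (linked ≡ true → ChosenWalk o v) → forestᵇ linked w ys ≡ false → ¬ GIndependent G X
  rejected⇒dependent o v linked []          []      _ _ _ _ ()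
  rejected⇒dependent o v linked []          (_ ∷ _) _ _ _ _ ()
  rejected⇒dependent o v linked (false ∷ w) []      _ _ _ _ ()
  rejected⇒dependent o v linked (true ∷ w)  []      _ _ _ _ ()
  rejected⇒dependent o v linked (false ∷ w) (false ∷ ys) G-o xs-o 1≤v walk forest
    with _ , G-o′ ← drop≡∷ o G G-o | _ , xs-o′ ← drop≡∷ o _ xs-o =
    rejected⇒dependent (suc o) v linked w ys G-o′ xs-o′ 1≤v (λ l → skipEdge (walk l)) forest
  rejected⇒dependent o v false (false ∷ w) (true ∷ ys) G-o xs-o 1≤v _ forest
    with Go , G-o′ ← drop≡∷ o G G-o | chosen , xs-o′ ← drop≡∷ o _ xs-o =
    rejected⇒dependent (suc o) v true w ys G-o′ xs-o′ 1≤v (λ _ → startWalk 1≤v Go chosen) forest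
  rejected⇒dependent o v true (false ∷ w) (true ∷ ys) G-o xs-o _ walk _
    with Go , _ ← drop≡∷ o G G-o | chosen , _ ← drop≡∷ o _ xs-o =
    closeWalk (walk refl) Go chosen
  rejected⇒dependent o v false (true ∷ w) (true ∷ ys) G-o xs-o 1≤v _ forest
    with _ , G-o′ ← drop≡∷ o G G-o | _ , xs-o′ ← drop≡∷ o _ xs-o =
    rejected⇒dependent (suc o) (suc v) false w ys G-o′ xs-o′ (≤-trans 1≤v (n≤1+n v)) (λ ()) forest
  rejected⇒dependent o v true (true ∷ w) (true ∷ ys) G-o xs-o 1≤v walk forest
    with Go , G-o′ ← drop≡∷ o G G-o | chosen , xs-o′ ← drop≡∷ o _ xs-o =
    rejected⇒dependent (suc o) (suc v) true w ys G-o′ xs-o′ (≤-trans 1≤v (n≤1+n v))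
      (λ _ → extendWalk (walk refl) Go chosen) forest
  rejected⇒dependent o v linked (true ∷ w) (false ∷ ys) G-o xs-o 1≤v _ forest
    with _ , G-o′ ← drop≡∷ o G G-o | _ , xs-o′ ← drop≡∷ o _ xs-o =
    rejected⇒dependent (suc o) (suc v) false w ys G-o′ xs-o′ (≤-trans 1≤v (n≤1+n v)) (λ ()) forest

independent⇒forest : ∀ w (X : Subset (length (fanGraph 1 w))) →
  GIndependent (fanGraph 1 w) X → forestᵇ false w (toList X) ≡ true
independent⇒forest w X independent with forestᵇ false w (toList X) in forest
... | true  = refl
... | false =
  ⊥-elim (Closing.rejected⇒dependent (fanGraph 1 w) X 0 1 false w (toList X) refl refl ≤-refl (λ ()) forest independent)

fanGraphBasis⇔treeᵇ : ∀ w (X : Subset (length (fanGraph 1 (w ++ E ∷ [])))) →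
  GBasis (fanGraph 1 (w ++ E ∷ [])) X ⇔ (treeᵇ false (w ++ E ∷ []) (toList X) ≡ true)
fanGraphBasis⇔treeᵇ w X = mk⇔ basis⇒tree tree⇒basis
  where
  W = w ++ E ∷ []
  G = fanGraph 1 W

  basis⇒tree : GBasis G X → treeᵇ false W (toList X) ≡ true
  basis⇒tree (independent , maximal) with treeᵇ false W (toList X) in tree
  ... | true  = refl
  ... | false with Y , (X⊆Y , new , new∈Y , new∉X) , forestY ←
                     forestᵇ-extension false w X (sym (length-fanGraph 1 W)) (independent⇒forest W X independent) tree
    = ⊥-elim (new∉X (maximal Y X⊆Y (forest⇒independent W Y forestY) new∈Y))

  tree⇒basis : treeᵇ false W (toList X) ≡ true → GBasis G X
  tree⇒basis tree = forest⇒independent W X (treeᵇ⇒forestᵇ false W (toList X) tree) , maximal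
    where
    maximal : ∀ Y → X ⊆ Y → GIndependent G Y → Y ⊆ X
    maximal Y X⊆Y independentY
      with _ , Y≡X ← treeᵇ-maximal W Bool.b≤b tree (independent⇒forest W Y independentY) X⊆Y = ⊆-reflexive Y≡X

-- Lattice paths in a diagram of width one

up : Bool → ℕ → ℕ
up true  d = suc d
up false d = d

ordered : ℕ → ℕ → ℕ → Bool
ordered dp db dq = does (dp ≤? db) ∧ does (db ≤? dq)

-- b stays weakly between p and q, the three paths starting at heights dp, db and dq.
betweenᵇ : ℕ → ℕ → ℕ → List Bool → List Bool → List Bool → Bool
betweenᵇ dp db dq []      []      []      = ordered dp db dq
betweenᵇ dp db dq (x ∷ p) (y ∷ b) (z ∷ q) = ordered dp db dq ∧ betweenᵇ (up x dp) (up y db) (up z dq) p b q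
betweenᵇ _ _ _ []      []      (_ ∷ _) = false
betweenᵇ _ _ _ []      (_ ∷ _) _       = false
betweenᵇ _ _ _ (_ ∷ _) []      _       = false
betweenᵇ _ _ _ (_ ∷ _) (_ ∷ _) []      = false

ordered-ribbon : ∀ linked d → ordered d (up linked d) (suc d) ≡ true
ordered-ribbon false d rewrite dec-true (d ≤? d) ≤-refl | dec-true (d ≤? suc d) (n≤1+n d) = refl
ordered-ribbon true  d rewrite dec-true (d ≤? suc d) (n≤1+n d) | dec-true (suc d ≤? suc d) ≤-refl = refl

ordered-refl : ∀ d → ordered d d d ≡ true
ordered-refl d rewrite dec-true (d ≤? d) ≤-refl = refl

ordered-below : ∀ dp db dq → db < dp → ordered dp db dq ≡ false
ordered-below dp db dq db<dp rewrite dec-false (dp ≤? db) (<⇒≱ db<dp) = refl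

ordered-above : ∀ dp db dq → dq < db → ordered dp db dq ≡ false
ordered-above dp db dq dq<db rewrite dec-false (db ≤? dq) (<⇒≱ dq<db) = ∧-zeroʳ (does (dp ≤? db))

betweenᵇ-unordered : ∀ {dp db dq} p b q → ordered dp db dq ≡ false → betweenᵇ dp db dq p b q ≡ false
betweenᵇ-unordered []      []      []      unordered = unordered
betweenᵇ-unordered (_ ∷ _) (_ ∷ _) (_ ∷ _) unordered rewrite unordered = refl
betweenᵇ-unordered []      []      (_ ∷ _) _ = refl
betweenᵇ-unordered []      (_ ∷ _) _       _ = refl
betweenᵇ-unordered (_ ∷ _) []      _       _ = refl
betweenᵇ-unordered (_ ∷ _) (_ ∷ _) []      _ = refl

-- Inside a ribbon of unit squares with lower boundary p = w N and upper boundary q = w E,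
-- a path b lies at one of the two heights of the boundaries, and linked records the upper one.
ribbon : ∀ w d linked b →
  betweenᵇ d (up linked d) (suc d) (w ++ N ∷ []) b (w ++ E ∷ []) ≡ treeᵇ linked (w ++ E ∷ []) b
ribbon []          d linked []      = refl
ribbon (false ∷ w) d linked []      = refl
ribbon (true ∷ w)  d linked []      = refl
ribbon [] d linked (y ∷ b) rewrite ordered-ribbon linked d with linked | y | b
... | false | true  | []    = ordered-refl (suc d)
... | true  | false | []    = ordered-refl (suc d)
... | false | false | []    = ordered-below (suc d) d (suc d) ≤-refl
... | true  | true  | []    = ordered-above (suc d) (suc (suc d)) (suc d) ≤-refl
... | _     | false | _ ∷ _ = refl
... | false | true  | _ ∷ _ = refl
... | true  | true  | _ ∷ _ = refl
ribbon (x ∷ w) d linked (y ∷ b) rewrite ordered-ribbon linked d with x | linked | y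
... | false | linked | false = ribbon w d linked b
... | false | false  | true  = ribbon w d true b
... | false | true   | true  =
  betweenᵇ-unordered (w ++ N ∷ []) b (w ++ E ∷ []) (ordered-above d (suc (suc d)) (suc d) ≤-refl)
... | true  | false  | true  = ribbon w (suc d) false b
... | true  | true   | true  = ribbon w (suc d) true b
... | true  | true   | false = ribbon w (suc d) false b
... | true  | false  | false =
  betweenᵇ-unordered (w ++ N ∷ []) b (w ++ E ∷ []) (ordered-below (suc d) d (suc (suc d)) ≤-refl)

BetweenAt : ℕ → ℕ → ℕ → List Bool → List Bool → List Bool → ℕ → Set
BetweenAt dp db dq p b q k = dp + height p k ≤ db + height b k × db + height b k ≤ dq + height q k

Between : ℕ → ℕ → ℕ → List Bool → List Bool → List Bool → Set
Between dp db dq p b q = ∀ k → k ≤ length p → BetweenAt dp db dq p b q k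

betweenAt-0 : ∀ dp db dq p b q → BetweenAt dp db dq p b q 0 ≡ (dp ≤ db × db ≤ dq)
betweenAt-0 dp db dq p b q rewrite +-identityʳ dp | +-identityʳ db | +-identityʳ dq = refl

+-height-∷ : ∀ d x p k → d + height (x ∷ p) (suc k) ≡ up x d + height p k
+-height-∷ d true  p k = +-suc d (height p k)
+-height-∷ d false p k = refl

betweenAt-∷ : ∀ dp db dq x y z p b q k →
  BetweenAt dp db dq (x ∷ p) (y ∷ b) (z ∷ q) (suc k) ≡ BetweenAt (up x dp) (up y db) (up z dq) p b q k
betweenAt-∷ dp db dq x y z p b q k rewrite +-height-∷ dp x p k | +-height-∷ db y b k | +-height-∷ dq z q k = refl

≤⇒ordered : ∀ {dp db dq} → dp ≤ db × db ≤ dq → ordered dp db dq ≡ true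
≤⇒ordered {dp} {db} {dq} (dp≤db , db≤dq) rewrite dec-true (dp ≤? db) dp≤db | dec-true (db ≤? dq) db≤dq = refl

ordered⇒≤ : ∀ dp db dq → ordered dp db dq ≡ true → dp ≤ db × db ≤ dq
ordered⇒≤ dp db dq ord with dp≤db , db≤dq ← Equivalence.to T-∧ (Equivalence.from T-≡ ord) =
  ≤ᵇ⇒≤ dp db dp≤db , ≤ᵇ⇒≤ db dq db≤dq

between⇒ordered : ∀ {dp db dq} p b q → Between dp db dq p b q → ordered dp db dq ≡ true
between⇒ordered {dp} {db} {dq} p b q between = ≤⇒ordered (subst id (betweenAt-0 dp db dq p b q) (between 0 z≤n))

ordered⇒betweenAt-0 : ∀ {dp db dq} p b q → ordered dp db dq ≡ true → BetweenAt dp db dq p b q 0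
ordered⇒betweenAt-0 {dp} {db} {dq} p b q ord =
  subst id (sym (betweenAt-0 dp db dq p b q)) (ordered⇒≤ dp db dq ord)

between-tail : ∀ {dp db dq} x y z p b q → Between dp db dq (x ∷ p) (y ∷ b) (z ∷ q) →
  Between (up x dp) (up y db) (up z dq) p b q
between-tail {dp} {db} {dq} x y z p b q between k k≤len =
  subst id (betweenAt-∷ dp db dq x y z p b q k) (between (suc k) (s≤s k≤len))

between-[] : ∀ {dp db dq} b q → ordered dp db dq ≡ true → Between dp db dq [] b q
between-[] b q ord zero z≤n = ordered⇒betweenAt-0 [] b q ord

between-∷ : ∀ {dp db dq} x y z p b q → ordered dp db dq ≡ true → Between (up x dp) (up y db) (up z dq) p b q →
  Between dp db dq (x ∷ p) (y ∷ b) (z ∷ q)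
between-∷ x y z p b q ord _ zero z≤n = ordered⇒betweenAt-0 (x ∷ p) (y ∷ b) (z ∷ q) ord
between-∷ {dp} {db} {dq} x y z p b q _ between (suc k) (s≤s k≤len) =
  subst id (sym (betweenAt-∷ dp db dq x y z p b q k)) (between k k≤len)

betweenᵇ⇒between : ∀ dp db dq p b q → betweenᵇ dp db dq p b q ≡ true → Between dp db dq p b q
betweenᵇ⇒between dp db dq []      []      []      ord = between-[] [] [] ord
betweenᵇ⇒between dp db dq (x ∷ p) (y ∷ b) (z ∷ q) bet with ordered dp db dq in ord
... | true = between-∷ x y z p b q ord (betweenᵇ⇒between (up x dp) (up y db) (up z dq) p b q bet)

between⇒betweenᵇ : ∀ {dp db dq} p b q → length b ≡ length p → length q ≡ length p →
  Between dp db dq p b q → betweenᵇ dp db dq p b q ≡ true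
between⇒betweenᵇ []      []      []      _ _ between = between⇒ordered [] [] [] between
between⇒betweenᵇ (x ∷ p) (y ∷ b) (z ∷ q) |b| |q| between rewrite between⇒ordered (x ∷ p) (y ∷ b) (z ∷ q) between =
  between⇒betweenᵇ p b q (suc-injective |b|) (suc-injective |q|) (between-tail x y z p b q between)

#N-++ : ∀ xs ys → #N (xs ++ ys) ≡ #N xs + #N ys
#N-++ []          ys = refl
#N-++ (true ∷ xs) ys = cong suc (#N-++ xs ys)
#N-++ (false ∷ xs) ys = #N-++ xs ys

height-all : ∀ xs {n} → length xs ≤ n → height xs n ≡ #N xs
height-all xs {n} len≤n = cong #N (take-all n xs len≤n)

snake-betweenᵇ≡treeᵇ : ∀ w y b →
  betweenᵇ 0 0 0 (E ∷ w ++ N ∷ []) (y ∷ b) (N ∷ w ++ E ∷ []) ≡ treeᵇ false (E ∷ w ++ E ∷ []) (y ∷ b)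
snake-betweenᵇ≡treeᵇ w true  b = ribbon w 0 true b
snake-betweenᵇ≡treeᵇ w false b = ribbon w 0 false b

-- LPMBasis P Q B unfolds to (#N B ≡ #N P) × Between 0 0 0 P B Q.
snakeBasis⇔treeᵇ : ∀ w (B : Subset (length (E ∷ w ++ N ∷ []))) →
  LPMBasis (E ∷ w ++ N ∷ []) (N ∷ w ++ E ∷ []) B ⇔ (treeᵇ false (E ∷ w ++ E ∷ []) (toList B) ≡ true)
snakeBasis⇔treeᵇ w B@(y ∷ᵛ B′) = mk⇔ basis⇒tree tree⇒basis
  where
  P = E ∷ w ++ N ∷ []
  Q = N ∷ w ++ E ∷ []
  b = toList B

  betweenᵇ≡treeᵇ : betweenᵇ 0 0 0 P b Q ≡ treeᵇ false (E ∷ w ++ E ∷ []) b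
  betweenᵇ≡treeᵇ = snake-betweenᵇ≡treeᵇ w y (toList B′)

  |b| : length b ≡ length P
  |b| = length-toList B

  |Q| : length Q ≡ length P
  |Q| = cong suc (trans (length-++ w) (sym (length-++ w)))

  #N[Q]≡#N[P] : #N Q ≡ #N P
  #N[Q]≡#N[P] = trans (cong suc (trans (#N-++ w (E ∷ [])) (+-identityʳ (#N w))))
                      (sym (trans (#N-++ w (N ∷ [])) (+-comm (#N w) 1)))

  basis⇒tree : LPMBasis P Q B → treeᵇ false (E ∷ w ++ E ∷ []) b ≡ true
  basis⇒tree (_ , between) = trans (sym betweenᵇ≡treeᵇ) (between⇒betweenᵇ P b Q |b| |Q| between)

  tree⇒basis : treeᵇ false (E ∷ w ++ E ∷ []) b ≡ true → LPMBasis P Q B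
  tree⇒basis tree = #N[b]≡#N[P] , between
    where
    between : Between 0 0 0 P b Q
    between = betweenᵇ⇒between 0 0 0 P b Q (trans betweenᵇ≡treeᵇ tree)
    #N[b]≡#N[P] : #N b ≡ #N P
    #N[b]≡#N[P] with lower , upper ← between (length P) ≤-refl = ≤-antisym
      (subst₂ _≤_ (height-all b (≤-reflexive |b|)) (trans (height-all Q (≤-reflexive |Q|)) #N[Q]≡#N[P]) upper)
      (subst₂ _≤_ (height-all P ≤-refl) (height-all b (≤-reflexive |b|)) lower)

cast-↔ : ∀ {m n} → m ≡ n → Fin m ↔ Fin n
cast-↔ eq = mk↔ₛ′ (cast eq) (cast (sym eq)) (cast-involutive eq (sym eq)) (cast-involutive (sym eq) eq)

toList-preimage-cast : ∀ {m n} (eq : m ≡ n) (Y : Subset n) → toList (preimage (cast eq) Y) ≡ toList Y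
toList-preimage-cast refl Y =
  cong toList (trans (tabulate-cong λ i → cong (Vec.lookup Y) (cast-is-id refl i)) (tabulate∘lookup Y))

snake≅fanGraph : ∀ w →
  MatroidIso (LPMBasis (E ∷ w ++ N ∷ []) (N ∷ w ++ E ∷ [])) (GBasis (fanGraph 1 (E ∷ w ++ E ∷ [])))
snake≅fanGraph w = cast-↔ |P|≡|G| , λ Y → ⇔-sym (snake⇔treeᵇ Y) ⇔-∘ fanGraphBasis⇔treeᵇ (E ∷ w) Y
  where
  P Q W : List Bool
  P = E ∷ w ++ N ∷ []
  Q = N ∷ w ++ E ∷ []
  W = E ∷ w ++ E ∷ []

  |P|≡|G| : length P ≡ length (fanGraph 1 W)
  |P|≡|G| = trans (cong suc (trans (length-++ w) (sym (length-++ w)))) (sym (length-fanGraph 1 W))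

  snake⇔treeᵇ : ∀ Y → LPMBasis P Q (preimage (cast |P|≡|G|) Y) ⇔ (treeᵇ false W (toList Y) ≡ true)
  snake⇔treeᵇ Y = subst (λ ys → LPMBasis P Q (preimage (cast |P|≡|G|) Y) ⇔ (treeᵇ false W ys ≡ true))
                        (toList-preimage-cast |P|≡|G| Y) (snakeBasis⇔treeᵇ w (preimage (cast |P|≡|G|) Y))

theorem3p2 : (a₁ : ℕ) (rest : List ℕ) → 1 ≤ a₁ → All (λ aᵢ → 2 ≤ aᵢ) rest →
    MatroidIso (SnakeBasis (a₁ ∷ rest)) (GBasis (multiFan (fanC (a₁ ∷ rest)) (fanD (a₁ ∷ rest))))
theorem3p2 a₁ rest 1≤a₁ rest≥2 rewrite multiFan-fanGraph a₁ rest 1≤a₁ rest≥2 =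
  snake≅fanGraph (snakeMoves E (a₁ ∷ rest))
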